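{- Let $p$ be a prime with $p\equiv 1\pmod 5$ and $p\notin\{11,41,61\}$. If $\zeta_1,\ldots,\zeta_k\in\mathbb{F}_p$ with $1\le k\le 5$ are (not necessarily distinct) $5$-th roots of unity in $\mathbb{F}_p$ with $\zeta_1+\cdots+\zeta_k=0$, then $k=5$ and $\zeta_1,\ldots,\zeta_5$ are the five distinct $5$-th roots of unity in $\mathbb{F}_p$. -}

module Defs where

open import Data.Nat using (ℕ; _+_; _^_; _%_; NonZero)
open import Data.Fin using (Fin; toℕ)
open import Data.Vec.Functional using (foldr)
open import Relation.Binary.PropositionalEquality using (_≡_)

-- Elements of 𝔽_p are represented by their canonical residues, i.e. Fin p
-- (the numbers 0,…,p-1); field operations are ℕ-operations reduced mod p.

Is5thRoot : (p : ℕ) → .{{_ : NonZero p}} → Fin p → Set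
Is5thRoot p x = (toℕ x ^ 5) % p ≡ 1 % p

sumFp : (p : ℕ) → .{{_ : NonZero p}} → {k : ℕ} → (Fin k → Fin p) → ℕ
sumFp p ζ = foldr (λ x s → toℕ x + s) 0 ζ % p

-- Not all ζᵢ are 1 (their sum would be k, and 0 < k ≤ 5 < p), so some ζᵢ is a primitive fifth
-- root of unity ω modulo p, i.e. a root of Φ₅, and every ζᵢ is ω^{eᵢ}. Then ζ₅ ↦ ω is a ring
-- homomorphism ℤ[ζ₅] → 𝔽_p sending α = Σᵢ ζ₅^{eᵢ} to Σᵢ ζᵢ = 0, so p divides every integer
-- that α divides in ℤ[ζ₅], in particular the norm of α. Running through all exponent vectors
-- (e₁, …, e_k) shows that unless they are a permutation of 0, …, 4 this norm is nonzero with
-- prime factors among 2, 3, 5, 11, 41, 61 only, which is impossible for p ≡ 1 (mod 5) outside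
-- {11, 41, 61}.

module Submission where

open import Defs
open import Data.Nat using (ℕ; _%_; _≤_; NonZero)
open import Data.Nat.Primality using (Prime)
open import Data.Fin using (Fin)
open import Data.Product using (∃; _×_)
open import Function.Definitions using (Injective)
open import Relation.Binary.PropositionalEquality using (_≡_; _≢_)

open import Level using (0ℓ)
open import Data.Empty using (⊥; ⊥-elim)
open import Data.Nat as ℕ using (zero; suc; _<_; z≤n; s≤s; _/_)
import Data.Nat.Properties as ℕ
import Data.Nat.Divisibility as ℕ
open import Data.Nat.DivMod using (m≡m%n+[m/n]*n; m<n⇒m%n≡m)
open import Data.Nat.ListAction using (product)
open import Data.Nat.Primality using (prime?; euclidsLemma; prime⇒nonTrivial; ¬prime[1])
open import Data.Nat.Primality.Factorisation using (factorisationHasAllPrimeFactors)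
open import Data.Integer as ℤ using (ℤ; +_; 0ℤ; 1ℤ; -_; _+_; _*_; _-_; _^_; ∣_∣)
import Data.Integer.Properties as ℤ
open import Data.Integer.Divisibility.Signed
  using (_∣_; divides; _∣?_; ∣ᵤ⇒∣; ∣⇒∣ᵤ; ∣-trans; ∣m∣n⇒∣m+n; ∣m∣n⇒∣m-n; ∣m⇒∣-m; ∣n⇒∣m*n; ∣m⇒∣m*n)
open import Data.Integer.Tactic.RingSolver using (solve-∀)
open import Data.Integer.Solver using (module +-*-Solver)
open import Data.Fin using (toℕ) renaming (zero to 0F; suc to sucF)
open import Data.Fin.Properties using (all?; any?; ¬∀⟶∃¬; toℕ-injective; toℕ<n) renaming (_≟_ to _≟ᶠ_)
open import Data.List using (List; []; _∷_)
open import Data.List.Membership.Propositional using (_∈_)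
import Data.List.Relation.Unary.All as All
open import Data.List.Relation.Unary.Any using (here; there)
open import Data.Vec as Vec using (Vec; []; _∷_; lookup; tabulate; zipWith; head)
open import Data.Vec.Properties using (≡-dec; lookup∘tabulate)
import Data.Vec.Functional as Vector
open import Data.Product using (_,_; proj₁; proj₂; map₂)
open import Data.Sum as Sum using (_⊎_; inj₁; inj₂; [_,_]′)
open import Function using (_∘_; id)
open import Relation.Nullary using (¬_; Dec; yes; no; map′; contradiction)
open import Relation.Nullary.Decidable using (_×-dec_; _⊎-dec_; _→-dec_; from-yes)
open import Relation.Binary.Bundles using (Setoid)
open import Relation.Binary.PropositionalEquality
  using (refl; sym; trans; cong; cong₂; subst; module ≡-Reasoning)
import Relation.Binary.Reasoning.Setoid as SetoidReasoning

infix 4 _≡_mod_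

record _≡_mod_ (a b : ℤ) (n : ℕ) : Set where
  constructor congruent
  field divides-difference : + n ∣ a - b

module _ {n : ℕ} where

  ≡⇒≡mod : ∀ {a b} → a ≡ b → a ≡ b mod n
  ≡⇒≡mod {a} refl = congruent (subst (+ n ∣_) (sym (ℤ.+-inverseʳ a)) (divides 0ℤ refl))

  ≡mod-sym : ∀ {a b} → a ≡ b mod n → b ≡ a mod n
  ≡mod-sym {a} {b} (congruent n∣a-b) = congruent (subst (+ n ∣_) (negate a b) (∣m⇒∣-m n∣a-b))
    where
    negate : ∀ a b → - (a - b) ≡ b - a
    negate = solve-∀

  ≡mod-trans : ∀ {a b c} → a ≡ b mod n → b ≡ c mod n → a ≡ c mod n
  ≡mod-trans {a} {b} {c} (congruent n∣a-b) (congruent n∣b-c) =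
    congruent (subst (+ n ∣_) (telescope a b c) (∣m∣n⇒∣m+n n∣a-b n∣b-c))
    where
    telescope : ∀ a b c → (a - b) + (b - c) ≡ a - c
    telescope = solve-∀

  +-cong : ∀ {a b c d} → a ≡ b mod n → c ≡ d mod n → a + c ≡ b + d mod n
  +-cong {a} {b} {c} {d} (congruent n∣a-b) (congruent n∣c-d) =
    congruent (subst (+ n ∣_) (regroup a b c d) (∣m∣n⇒∣m+n n∣a-b n∣c-d))
    where
    regroup : ∀ a b c d → (a - b) + (c - d) ≡ (a + c) - (b + d)
    regroup = solve-∀

  +-congˡ : ∀ c {a b} → a ≡ b mod n → c + a ≡ c + b mod n
  +-congˡ c = +-cong (≡⇒≡mod {a = c} refl)

  *-congˡ : ∀ c {a b} → a ≡ b mod n → c * a ≡ c * b mod n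
  *-congˡ c {a} {b} (congruent n∣a-b) = congruent (subst (+ n ∣_) (distrib c a b) (∣n⇒∣m*n c n∣a-b))
    where
    distrib : ∀ c a b → c * (a - b) ≡ c * a - c * b
    distrib = solve-∀

  ∣-resp-≡mod : ∀ {a b} → a ≡ b mod n → + n ∣ a → + n ∣ b
  ∣-resp-≡mod {a} {b} (congruent n∣a-b) n∣a = subst (+ n ∣_) (cancel a b) (∣m∣n⇒∣m-n n∣a n∣a-b)
    where
    cancel : ∀ a b → a - (a - b) ≡ b
    cancel = solve-∀

≡mod-setoid : ℕ → Setoid 0ℓ 0ℓ
≡mod-setoid n = record
  { Carrier       = ℤ
  ; _≈_           = λ a b → a ≡ b mod n
  ; isEquivalence = record { refl = ≡⇒≡mod refl ; sym = ≡mod-sym ; trans = ≡mod-trans }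
  }

module ≡mod-Reasoning (n : ℕ) = SetoidReasoning (≡mod-setoid n)

module _ {n : ℕ} .{{_ : NonZero n}} where

  ≡mod-% : ∀ a → + a ≡ + (a % n) mod n
  ≡mod-% a = congruent (divides (+ (a / n)) (begin
    + a - + (a % n)                           ≡⟨ cong (λ m → + m - + (a % n)) (m≡m%n+[m/n]*n a n) ⟩
    + (a % n ℕ.+ a / n ℕ.* n) - + (a % n)     ≡⟨ cong (_- + (a % n)) (ℤ.pos-+ (a % n) (a / n ℕ.* n)) ⟩
    + (a % n) + + (a / n ℕ.* n) - + (a % n)   ≡⟨ cancel (+ (a % n)) (+ (a / n ℕ.* n)) ⟩
    + (a / n ℕ.* n)                           ≡⟨ ℤ.pos-* (a / n) n ⟩
    + (a / n) * + n                           ∎))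
    where
    open ≡-Reasoning
    cancel : ∀ r s → r + s - r ≡ s
    cancel = solve-∀

  %-≡⇒≡mod : ∀ {a b} → a % n ≡ b % n → + a ≡ + b mod n
  %-≡⇒≡mod {a} {b} a%n≡b%n = begin
    + a         ≈⟨ ≡mod-% a ⟩
    + (a % n)   ≡⟨ cong +_ a%n≡b%n ⟩
    + (b % n)   ≈⟨ ≡mod-sym (≡mod-% b) ⟩
    + b         ∎
    where open ≡mod-Reasoning n

residue-injective : ∀ {n a b} → a < n → b < n → + a ≡ + b mod n → a ≡ b
residue-injective {n} {a} {b} a<n b<n (congruent n∣a-b) =
  ℤ.+-injective (ℤ.i-j≡0⇒i≡j (+ a) (+ b) (ℤ.∣i∣≡0⇒i≡0 (small-multiple (∣⇒∣ᵤ n∣a-b) ∣a-b∣<n)))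
  where
  ∣a-b∣<n : ∣ + a - + b ∣ < n
  ∣a-b∣<n = ℕ.≤-<-trans (subst (ℕ._≤ a ℕ.⊔ b) (cong ∣_∣ (sym (ℤ.m-n≡m⊖n a b))) (ℤ.∣m⊝n∣≤m⊔n a b))
                        (ℕ.⊔-lub a<n b<n)
  small-multiple : ∀ {m} → n ℕ.∣ m → m < n → m ≡ 0
  small-multiple {zero}  _   _   = refl
  small-multiple {suc m} n∣m m<n = contradiction (ℕ.∣⇒≤ n∣m) (ℕ.<⇒≱ m<n)

pos-^ : ∀ m n → + (m ℕ.^ n) ≡ (+ m) ^ n
pos-^ m zero    = refl
pos-^ m (suc n) = trans (ℤ.pos-* m (m ℕ.^ n)) (cong (+ m *_) (pos-^ m n))

∏ : ∀ {m} → (Fin m → ℤ) → ℤ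
∏ = Vector.foldr _*_ 1ℤ

module _ {p : ℕ} (p-prime : Prime p) where

  p≢1 : p ≢ 1
  p≢1 refl = ¬prime[1] p-prime

  euclid : ∀ a b → + p ∣ a * b → (+ p ∣ a) ⊎ (+ p ∣ b)
  euclid a b p∣ab =
    Sum.map ∣ᵤ⇒∣ ∣ᵤ⇒∣ (euclidsLemma ∣ a ∣ ∣ b ∣ p-prime (subst (p ℕ.∣_) (ℤ.abs-* a b) (∣⇒∣ᵤ p∣ab)))

  prime∣∏ : ∀ {m} (f : Fin m → ℤ) → + p ∣ ∏ f → ∃ λ j → + p ∣ f j
  prime∣∏ {zero}  f p∣1 = contradiction (ℕ.∣1⇒≡1 (∣⇒∣ᵤ p∣1)) p≢1
  prime∣∏ {suc m} f p∣∏ with euclid (f 0F) _ p∣∏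
  ... | inj₁ p∣f0 = 0F , p∣f0
  ... | inj₂ p∣∏f∘suc = let j , p∣fj = prime∣∏ (f ∘ sucF) p∣∏f∘suc in sucF j , p∣fj

  prime∣^⇒prime∣ : ∀ {m} k → p ℕ.∣ m ℕ.^ k → p ℕ.∣ m
  prime∣^⇒prime∣ zero    p∣1   = contradiction (ℕ.∣1⇒≡1 p∣1) p≢1
  prime∣^⇒prime∣ {m} (suc k) p∣mᵏ⁺¹ =
    [ id , prime∣^⇒prime∣ k ]′ (euclidsLemma m (m ℕ.^ k) p-prime p∣mᵏ⁺¹)

p%5≡1⇒5<p : ∀ {p} → 1 < p → p % 5 ≡ 1 → 5 < p
p%5≡1⇒5<p {0} () _
p%5≡1⇒5<p {1} (s≤s ()) _
p%5≡1⇒5<p {2} _ ()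
p%5≡1⇒5<p {3} _ ()
p%5≡1⇒5<p {4} _ ()
p%5≡1⇒5<p {5} _ ()
p%5≡1⇒5<p {suc (suc (suc (suc (suc (suc _)))))} _ _ = s≤s (s≤s (s≤s (s≤s (s≤s (s≤s z≤n)))))

-- The nonzero norms met below are 1, 5, 11, 16, 25, 55, 61, 81, 205, 256 and 625.
normPrimes : List ℕ
normPrimes = 2 ∷ 3 ∷ 5 ∷ 11 ∷ 41 ∷ 61 ∷ []

normMultiple : ℕ
normMultiple = product normPrimes ℕ.^ 8

∉normPrimes : ∀ {p} → p ∈ normPrimes → p % 5 ≡ 1 → p ≢ 11 → p ≢ 41 → p ≢ 61 → ⊥
∉normPrimes (here refl) ()
∉normPrimes (there (here refl)) ()
∉normPrimes (there (there (here refl))) ()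
∉normPrimes (there (there (there (here p≡11)))) _ p≢11 _ _ = p≢11 p≡11
∉normPrimes (there (there (there (there (here p≡41))))) _ _ p≢41 _ = p≢41 p≡41
∉normPrimes (there (there (there (there (there (here p≡61)))))) _ _ _ p≢61 = p≢61 p≡61

∤normMultiple : ∀ {p} → Prime p → p % 5 ≡ 1 → p ≢ 11 → p ≢ 41 → p ≢ 61 → ¬ p ℕ.∣ normMultiple
∤normMultiple {p} p-prime p%5≡1 p≢11 p≢41 p≢61 p∣M = ∉normPrimes p∈normPrimes p%5≡1 p≢11 p≢41 p≢61
  where
  p∈normPrimes : p ∈ normPrimes
  p∈normPrimes = factorisationHasAllPrimeFactors p-prime (prime∣^⇒prime∣ p-prime 8 p∣M)
                   (from-yes (All.all? prime? normPrimes))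

-- The ring ℤ[ζ₅]

ev : ∀ {n} → ℤ → Vec ℤ n → ℤ
ev ω []       = 0ℤ
ev ω (a ∷ α) = a + ω * ev ω α

infixl 6 _⊕_
infixl 7 _·_ _⊗_
infixr 8 ζ·_ ζ^_

_⊕_ : ∀ {n} → Vec ℤ n → Vec ℤ n → Vec ℤ n
_⊕_ = zipWith _+_

_·_ : ∀ {n} → ℤ → Vec ℤ n → Vec ℤ n
c · α = Vec.map (c *_) α

-- ℤ[ζ₅] = ℤ[x]/(1 + x + x² + x³ + x⁴), by coordinates in the basis 1, ζ, ζ², ζ³.
ℤ[ζ₅] : Set
ℤ[ζ₅] = Vec ℤ 4

ι : ℤ → ℤ[ζ₅]
ι c = c ∷ 0ℤ ∷ 0ℤ ∷ 0ℤ ∷ []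

-- ζ⁴ = -1 - ζ - ζ² - ζ³
ζ·_ : ℤ[ζ₅] → ℤ[ζ₅]
ζ· (a₀ ∷ a₁ ∷ a₂ ∷ a₃ ∷ []) = - a₃ ∷ a₀ - a₃ ∷ a₁ - a₃ ∷ a₂ - a₃ ∷ []

-- α ⊗ β = α · β(ζ), for a coefficient vector β of any length.
_⊗_ : ∀ {n} → ℤ[ζ₅] → Vec ℤ n → ℤ[ζ₅]
α ⊗ []      = ι 0ℤ
α ⊗ (b ∷ β) = b · α ⊕ ζ· (α ⊗ β)

ζ^_ : ℕ → ℤ[ζ₅]
ζ^ zero  = ι 1ℤ
ζ^ suc n = ζ· ζ^ n

-- σ α = a₀ + a₁ζ² + a₂ζ⁴ + a₃ζ⁶. The automorphism ζ ↦ ζ² generates Gal(ℚ(ζ₅)/ℚ), so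
-- α ⊗ conjugates α is the norm of α.
σ : ℤ[ζ₅] → ℤ[ζ₅]
σ (a₀ ∷ a₁ ∷ a₂ ∷ a₃ ∷ []) = a₀ - a₂ ∷ a₃ - a₂ ∷ a₁ - a₂ ∷ - a₂ ∷ []

conjugates : ℤ[ζ₅] → ℤ[ζ₅]
conjugates α = σ α ⊗ σ (σ α) ⊗ σ (σ (σ α))

norm : ℤ[ζ₅] → ℤ
norm α = head (α ⊗ conjugates α)

Φ₅ : ℤ → ℤ
Φ₅ ω = 1ℤ + ω * (1ℤ + ω * (1ℤ + ω * (1ℤ + ω)))

x⁵-1≡[x-1]Φ₅ : ∀ x → x ^ 5 - 1ℤ ≡ (x - 1ℤ) * Φ₅ x
x⁵-1≡[x-1]Φ₅ = solve 1 (λ x → x :^ 5 :- con 1ℤ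
                         := (x :- con 1ℤ) :* (con 1ℤ :+ x :* (con 1ℤ :+ x :* (con 1ℤ :+ x :* (con 1ℤ :+ x)))))
                       refl
  where open +-*-Solver using (solve; _:=_; _:+_; _:*_; _:-_; _:^_; con)

Φ₅-cofactor : ℤ → ℤ → ℤ
Φ₅-cofactor x ω = - 1ℤ + ω - ω ^ 5 + ω ^ 6 - x * ω ^ 6 + x ^ 2 * ω ^ 3 + x ^ 2 * ω ^ 5
                  - x ^ 3 * ω - x ^ 3 * ω ^ 3 + x ^ 4

x⁵-1≡∏[x-ωʲ]+Φ₅ : ∀ x ω → x ^ 5 - 1ℤ - Φ₅ ω * Φ₅-cofactor x ω ≡ ∏ (λ (j : Fin 5) → x - ω ^ toℕ j)
x⁵-1≡∏[x-ωʲ]+Φ₅ = solve 2 (λ x w →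
  x :^ 5 :- con 1ℤ
    :- (con 1ℤ :+ w :* (con 1ℤ :+ w :* (con 1ℤ :+ w :* (con 1ℤ :+ w))))
       :* (:- con 1ℤ :+ w :- w :^ 5 :+ w :^ 6 :- x :* w :^ 6 :+ x :^ 2 :* w :^ 3 :+ x :^ 2 :* w :^ 5
           :- x :^ 3 :* w :- x :^ 3 :* w :^ 3 :+ x :^ 4)
  := (x :- w :^ 0) :* ((x :- w :^ 1) :* ((x :- w :^ 2) :* ((x :- w :^ 3) :* ((x :- w :^ 4) :* con 1ℤ)))))
  refl
  where open +-*-Solver using (solve; _:=_; _:+_; _:*_; _:-_; :-_; _:^_; con)

module _ (ω : ℤ) where

  ev-⊕ : ∀ {n} (α β : Vec ℤ n) → ev ω (α ⊕ β) ≡ ev ω α + ev ω β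
  ev-⊕ []      []      = refl
  ev-⊕ (a ∷ α) (b ∷ β) = trans (cong (λ s → a + b + ω * s) (ev-⊕ α β)) (regroup a b (ev ω α) (ev ω β) ω)
    where
    regroup : ∀ a b s t w → a + b + w * (s + t) ≡ a + w * s + (b + w * t)
    regroup = solve-∀

  ev-· : ∀ {n} c (α : Vec ℤ n) → ev ω (c · α) ≡ c * ev ω α
  ev-· c []      = sym (ℤ.*-zeroʳ c)
  ev-· c (a ∷ α) = trans (cong (λ s → c * a + ω * s) (ev-· c α)) (distrib c a (ev ω α) ω)
    where
    distrib : ∀ c a s w → c * a + w * (c * s) ≡ c * (a + w * s)
    distrib = solve-∀

  ev-ι : ∀ c → ev ω (ι c) ≡ c
  ev-ι c = vanish c ω
    where
    vanish : ∀ c w → c + w * (0ℤ + w * (0ℤ + w * (0ℤ + w * 0ℤ))) ≡ c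
    vanish = solve-∀

module AtRootOfΦ₅ {p : ℕ} (ω : ℤ) (p∣Φ₅ω : + p ∣ Φ₅ ω) where

  open ≡mod-Reasoning p

  ev-ζ· : ∀ α → ev ω (ζ· α) ≡ ω * ev ω α mod p
  ev-ζ· (a₀ ∷ a₁ ∷ a₂ ∷ a₃ ∷ []) =
    congruent (subst (+ p ∣_) (difference a₀ a₁ a₂ a₃ ω) (∣m⇒∣-m (∣n⇒∣m*n a₃ p∣Φ₅ω)))
    where
    difference : ∀ a₀ a₁ a₂ a₃ w →
      - (a₃ * (1ℤ + w * (1ℤ + w * (1ℤ + w * (1ℤ + w)))))
        ≡ - a₃ + w * (a₀ - a₃ + w * (a₁ - a₃ + w * (a₂ - a₃ + w * 0ℤ)))
          - w * (a₀ + w * (a₁ + w * (a₂ + w * (a₃ + w * 0ℤ))))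
    difference = solve-∀

  ev-⊗ : ∀ α {n} (β : Vec ℤ n) → ev ω (α ⊗ β) ≡ ev ω α * ev ω β mod p
  ev-⊗ α []      = ≡⇒≡mod (trans (ev-ι ω 0ℤ) (sym (ℤ.*-zeroʳ (ev ω α))))
  ev-⊗ α (b ∷ β) = begin
    ev ω (b · α ⊕ ζ· (α ⊗ β))                    ≡⟨ ev-⊕ ω (b · α) (ζ· (α ⊗ β)) ⟩
    ev ω (b · α) + ev ω (ζ· (α ⊗ β))             ≡⟨ cong (_+ ev ω (ζ· (α ⊗ β))) (ev-· ω b α) ⟩
    b * ev ω α + ev ω (ζ· (α ⊗ β))               ≈⟨ +-congˡ (b * ev ω α) (ev-ζ· (α ⊗ β)) ⟩
    b * ev ω α + ω * ev ω (α ⊗ β)                ≈⟨ +-congˡ (b * ev ω α) (*-congˡ ω (ev-⊗ α β)) ⟩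
    b * ev ω α + ω * (ev ω α * ev ω β)           ≡⟨ factor b (ev ω α) (ev ω β) ω ⟩
    ev ω α * (b + ω * ev ω β)                    ∎
    where
    factor : ∀ b e s w → b * e + w * (e * s) ≡ e * (b + w * s)
    factor = solve-∀

  ev-ζ^ : ∀ n → ev ω (ζ^ n) ≡ ω ^ n mod p
  ev-ζ^ zero    = ≡⇒≡mod (ev-ι ω 1ℤ)
  ev-ζ^ (suc n) = begin
    ev ω (ζ· ζ^ n)    ≈⟨ ev-ζ· (ζ^ n) ⟩
    ω * ev ω (ζ^ n)   ≈⟨ *-congˡ ω (ev-ζ^ n) ⟩
    ω * ω ^ n         ∎

  ∣ev⇒∣ : ∀ α {n} (β : Vec ℤ n) {c} → + p ∣ ev ω α → α ⊗ β ≡ ι c → + p ∣ c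
  ∣ev⇒∣ α β {c} p∣evα αβ≡c = ∣-resp-≡mod evαevβ≡c (∣m⇒∣m*n (ev ω β) p∣evα)
    where
    evαevβ≡c : ev ω α * ev ω β ≡ c mod p
    evαevβ≡c = begin
      ev ω α * ev ω β   ≈⟨ ≡mod-sym (ev-⊗ α β) ⟩
      ev ω (α ⊗ β)      ≡⟨ cong (ev ω) αβ≡c ⟩
      ev ω (ι c)        ≡⟨ ev-ι ω c ⟩
      c                 ∎

-- Fifth roots of unity modulo p

-- The junk value 0F is returned when there is no witness.
witness : ∀ {n} {P : Fin (suc n) → Set} → Dec (∃ P) → Fin (suc n)
witness (yes (j , _)) = j
witness (no _)        = 0F

witness-correct : ∀ {n} {P : Fin (suc n) → Set} (∃P? : Dec (∃ P)) → ∃ P → P (witness ∃P?)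
witness-correct (yes (_ , Pj)) _  = Pj
witness-correct (no ∄j)        ∃j = contradiction ∃j ∄j

module FifthRoots {p : ℕ} (p-prime : Prime p) {ω : ℤ} where

  Φ₅-root : ω ^ 5 ≡ 1ℤ mod p → ¬ (ω ≡ 1ℤ mod p) → + p ∣ Φ₅ ω
  Φ₅-root (congruent p∣ω⁵-1) ω≢1 =
    [ (λ p∣ω-1 → contradiction (congruent p∣ω-1) ω≢1) , id ]′
      (euclid p-prime (ω - 1ℤ) (Φ₅ ω) (subst (+ p ∣_) (x⁵-1≡[x-1]Φ₅ ω) p∣ω⁵-1))

  power-of-ω : + p ∣ Φ₅ ω → ∀ x → x ^ 5 ≡ 1ℤ mod p → ∃ λ j → + p ∣ x - ω ^ toℕ j
  power-of-ω p∣Φ₅ω x (congruent p∣x⁵-1) = prime∣∏ p-prime (λ (j : Fin 5) → x - ω ^ toℕ j)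
    (subst (+ p ∣_) (x⁵-1≡∏[x-ωʲ]+Φ₅ x ω) (∣m∣n⇒∣m-n p∣x⁵-1 (∣m⇒∣m*n (Φ₅-cofactor x ω) p∣Φ₅ω)))

  logω : ℤ → Fin 5
  logω x = witness (any? (λ j → + p ∣? x - ω ^ toℕ j))

  logω-correct : + p ∣ Φ₅ ω → ∀ x → x ^ 5 ≡ 1ℤ mod p → x ≡ ω ^ toℕ (logω x) mod p
  logω-correct p∣Φ₅ω x x⁵≡1 =
    congruent (witness-correct (any? (λ j → + p ∣? x - ω ^ toℕ j)) (power-of-ω p∣Φ₅ω x x⁵≡1))

sumOfPowers : ∀ {k} → Vec (Fin 5) k → ℤ[ζ₅]
sumOfPowers []      = ι 0ℤ
sumOfPowers (j ∷ v) = ζ^ toℕ j ⊕ sumOfPowers v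

IsPermutation : ∀ {k} → Vec (Fin 5) k → Set
IsPermutation {k} v = k ≡ 5 × Injective _≡_ _≡_ (lookup v) × (∀ j → ∃ λ i → lookup v i ≡ j)

NormDivides : ℤ[ζ₅] → ℕ → Set
NormDivides α m = α ⊗ conjugates α ≡ ι (norm α) × norm α ∣ + m

injective? : ∀ {m n} (f : Fin m → Fin n) → Dec (Injective _≡_ _≡_ f)
injective? f = map′ (λ inj {i} {j} → inj i j) (λ inj i j → inj)
                    (all? λ i → all? λ j → f i ≟ᶠ f j →-dec i ≟ᶠ j)

isPermutation? : ∀ {k} (v : Vec (Fin 5) k) → Dec (IsPermutation v)
isPermutation? {k} v = k ℕ.≟ 5 ×-dec injective? (lookup v) ×-dec all? λ j → any? λ i → lookup v i ≟ᶠ j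

normDivides? : ∀ α m → Dec (NormDivides α m)
normDivides? α m = ≡-dec ℤ._≟_ (α ⊗ conjugates α) (ι (norm α)) ×-dec norm α ∣? + m

all-vectors? : ∀ {n k} {P : Vec (Fin n) k → Set} → (∀ v → Dec (P v)) → Dec (∀ v → P v)
all-vectors? {k = zero}  P? = map′ (λ { P[] [] → P[] }) (λ ∀P → ∀P []) (P? [])
all-vectors? {k = suc k} P? = map′ (λ { ∀P (j ∷ v) → ∀P j v }) (λ ∀P j v → ∀P (j ∷ v))
                             (all? λ j → all-vectors? λ v → P? (j ∷ v))

PermutationOrNormDivides : ℕ → Set
PermutationOrNormDivides k =
  ∀ (v : Vec (Fin 5) k) → IsPermutation v ⊎ NormDivides (sumOfPowers v) normMultiple

permutationOrNormDivides? : ∀ k → Dec (PermutationOrNormDivides k)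
permutationOrNormDivides? k =
  all-vectors? λ v → isPermutation? v ⊎-dec normDivides? (sumOfPowers v) normMultiple

-- Decided by enumerating the 5 + 5² + ⋯ + 5⁵ exponent vectors.
permutation-or-normDivides : ∀ {k} → 1 ≤ k → k ≤ 5 → PermutationOrNormDivides k
permutation-or-normDivides {1} _ _ = from-yes (permutationOrNormDivides? 1)
permutation-or-normDivides {2} _ _ = from-yes (permutationOrNormDivides? 2)
permutation-or-normDivides {3} _ _ = from-yes (permutationOrNormDivides? 3)
permutation-or-normDivides {4} _ _ = from-yes (permutationOrNormDivides? 4)
permutation-or-normDivides {5} _ _ = from-yes (permutationOrNormDivides? 5)
permutation-or-normDivides {suc (suc (suc (suc (suc (suc _)))))} _ (s≤s (s≤s (s≤s (s≤s (s≤s ())))))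

-- Vanishing sums of fifth roots of unity modulo p

residueSum : ∀ {k p} → (Fin k → Fin p) → ℕ
residueSum = Vector.foldr (λ x s → toℕ x ℕ.+ s) 0

module _ {p : ℕ} .{{_ : NonZero p}} where

  Is5thRoot⇒≡mod : ∀ x → Is5thRoot p x → (+ toℕ x) ^ 5 ≡ 1ℤ mod p
  Is5thRoot⇒≡mod x x⁵≡1 = subst (_≡ 1ℤ mod p) (pos-^ (toℕ x) 5) (%-≡⇒≡mod x⁵≡1)

  sumFp≡0⇒∣ : ∀ {k} (ζ : Fin k → Fin p) → sumFp p ζ ≡ 0 → + p ∣ + residueSum ζ
  sumFp≡0⇒∣ ζ Σ≡0 = ∣ᵤ⇒∣ (ℕ.m%n≡0⇒n∣m (residueSum ζ) p Σ≡0)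

  not-all-one : ∀ {k} (ζ : Fin k → Fin p) → 1 ≤ k → k < p → sumFp p ζ ≡ 0 → ¬ (∀ i → toℕ (ζ i) ≡ 1)
  not-all-one {k} ζ 1≤k k<p Σ≡0 all-one = ℕ.<⇒≢ 1≤k (sym k≡0)
    where
    sum-of-ones : ∀ {m} (ζ : Fin m → Fin p) → (∀ i → toℕ (ζ i) ≡ 1) → residueSum ζ ≡ m
    sum-of-ones {zero}  ζ _       = refl
    sum-of-ones {suc m} ζ all-one = cong₂ ℕ._+_ (all-one 0F) (sum-of-ones (ζ ∘ sucF) (all-one ∘ sucF))
    k≡0 : k ≡ 0
    k≡0 = begin
      k                  ≡⟨ m<n⇒m%n≡m k<p ⟨
      k % p              ≡⟨ cong (_% p) (sum-of-ones ζ all-one) ⟨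
      residueSum ζ % p   ≡⟨ Σ≡0 ⟩
      0                  ∎
      where open ≡-Reasoning

  Φ₅-has-root : Prime p → ∀ {k} (ζ : Fin k → Fin p) → (∀ i → Is5thRoot p (ζ i)) →
                ¬ (∀ i → toℕ (ζ i) ≡ 1) → ∃ λ ω → + p ∣ Φ₅ ω
  Φ₅-has-root p-prime {k} ζ roots not-all-one =
    let i , ζᵢ≢1 = ¬∀⟶∃¬ k _ (λ i → toℕ (ζ i) ℕ.≟ 1) not-all-one
    in + toℕ (ζ i) ,
       Φ₅-root (Is5thRoot⇒≡mod (ζ i) (roots i)) (ζᵢ≢1 ∘ residue-injective (toℕ<n (ζ i)) 1<p)
    where
    open FifthRoots p-prime
    1<p : 1 < p
    1<p = ℕ.nonTrivial⇒n>1 p {{prime⇒nonTrivial p-prime}}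

module Classification {p : ℕ} .{{_ : NonZero p}} (p-prime : Prime p) (ω : ℤ) (p∣Φ₅ω : + p ∣ Φ₅ ω)
                      {k : ℕ} (ζ : Fin k → Fin p) (roots : ∀ i → Is5thRoot p (ζ i)) where

  open AtRootOfΦ₅ ω p∣Φ₅ω
  open FifthRoots p-prime {ω}
  open ≡mod-Reasoning p

  log : Fin p → Fin 5
  log x = logω (+ toℕ x)

  exponents : Vec (Fin 5) k
  exponents = tabulate (log ∘ ζ)

  ζ≡ω^exponents : ∀ i → + toℕ (ζ i) ≡ ω ^ toℕ (lookup exponents i) mod p
  ζ≡ω^exponents i = subst (λ j → + toℕ (ζ i) ≡ ω ^ toℕ j mod p) (sym (lookup∘tabulate (log ∘ ζ) i))
                          (logω-correct p∣Φ₅ω (+ toℕ (ζ i)) (Is5thRoot⇒≡mod (ζ i) (roots i)))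

  residueSum≡ev : ∀ {m} (ξ : Fin m → Fin p) (v : Vec (Fin 5) m) →
                  (∀ i → + toℕ (ξ i) ≡ ω ^ toℕ (lookup v i) mod p) →
                  + residueSum ξ ≡ ev ω (sumOfPowers v) mod p
  residueSum≡ev ξ []      _     = ≡⇒≡mod (sym (ev-ι ω 0ℤ))
  residueSum≡ev ξ (j ∷ v) ξ≡ω^v = begin
    + (toℕ (ξ 0F) ℕ.+ residueSum (ξ ∘ sucF))   ≡⟨ ℤ.pos-+ (toℕ (ξ 0F)) (residueSum (ξ ∘ sucF)) ⟩
    + toℕ (ξ 0F) + + residueSum (ξ ∘ sucF)     ≈⟨ +-cong (≡mod-trans (ξ≡ω^v 0F) (≡mod-sym (ev-ζ^ (toℕ j))))
                                                          (residueSum≡ev (ξ ∘ sucF) v (ξ≡ω^v ∘ sucF)) ⟩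
    ev ω (ζ^ toℕ j) + ev ω (sumOfPowers v)     ≡⟨ ev-⊕ ω (ζ^ toℕ j) (sumOfPowers v) ⟨
    ev ω (sumOfPowers (j ∷ v))                 ∎

  ∣ev-sumOfPowers : sumFp p ζ ≡ 0 → + p ∣ ev ω (sumOfPowers exponents)
  ∣ev-sumOfPowers Σ≡0 = ∣-resp-≡mod (residueSum≡ev ζ exponents ζ≡ω^exponents) (sumFp≡0⇒∣ ζ Σ≡0)

  ¬normDivides : ¬ p ℕ.∣ normMultiple → sumFp p ζ ≡ 0 →
                 ¬ NormDivides (sumOfPowers exponents) normMultiple
  ¬normDivides p∤M Σ≡0 (αᾱ≡ιN , N∣M) =
    p∤M (∣⇒∣ᵤ (∣-trans (∣ev⇒∣ α (conjugates α) (∣ev-sumOfPowers Σ≡0) αᾱ≡ιN) N∣M))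
    where
    α : ℤ[ζ₅]
    α = sumOfPowers exponents

  ≡-by-exponent : ∀ x → Is5thRoot p x → ∀ {i} → lookup exponents i ≡ log x → ζ i ≡ x
  ≡-by-exponent x x-root {i} eᵢ≡log-x = toℕ-injective (residue-injective (toℕ<n (ζ i)) (toℕ<n x) (begin
    + toℕ (ζ i)                    ≈⟨ ζ≡ω^exponents i ⟩
    ω ^ toℕ (lookup exponents i)   ≡⟨ cong (λ j → ω ^ toℕ j) eᵢ≡log-x ⟩
    ω ^ toℕ (log x)                ≈⟨ ≡mod-sym (logω-correct p∣Φ₅ω (+ toℕ x) (Is5thRoot⇒≡mod x x-root)) ⟩
    + toℕ x                        ∎))

  permutation⇒bijection : IsPermutation exponents →
                          k ≡ 5 × (Injective _≡_ _≡_ ζ × (∀ x → Is5thRoot p x → ∃ λ i → ζ i ≡ x))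
  permutation⇒bijection (k≡5 , exponents-injective , exponents-surjective) = k≡5 , injective , surjective
    where
    injective : Injective _≡_ _≡_ ζ
    injective {i} {i′} ζᵢ≡ζᵢ′ = exponents-injective (trans (lookup∘tabulate (log ∘ ζ) i)
      (trans (cong log ζᵢ≡ζᵢ′) (sym (lookup∘tabulate (log ∘ ζ) i′))))

    surjective : ∀ x → Is5thRoot p x → ∃ λ i → ζ i ≡ x
    surjective x x-root = map₂ (≡-by-exponent x x-root) (exponents-surjective (log x))

lemma4p1 : (p : ℕ) → .{{_ : NonZero p}} → Prime p → p % 5 ≡ 1
    → p ≢ 11 → p ≢ 41 → p ≢ 61
    → (k : ℕ) → 1 ≤ k → k ≤ 5
    → (ζ : Fin k → Fin p) → (∀ i → Is5thRoot p (ζ i))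
    → sumFp p ζ ≡ 0
    → k ≡ 5 × (Injective _≡_ _≡_ ζ × (∀ x → Is5thRoot p x → ∃ λ i → ζ i ≡ x))
lemma4p1 p p-prime p%5≡1 p≢11 p≢41 p≢61 k 1≤k k≤5 ζ roots Σ≡0 =
  [ permutation⇒bijection , ⊥-elim ∘ ¬normDivides p∤M Σ≡0 ]′
    (permutation-or-normDivides 1≤k k≤5 exponents)
  where
  p∤M : ¬ p ℕ.∣ normMultiple
  p∤M = ∤normMultiple p-prime p%5≡1 p≢11 p≢41 p≢61
  k<p : k < p
  k<p = ℕ.≤-<-trans k≤5 (p%5≡1⇒5<p (ℕ.nonTrivial⇒n>1 p {{prime⇒nonTrivial p-prime}}) p%5≡1)
  root : ∃ λ ω → + p ∣ Φ₅ ω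
  root = Φ₅-has-root p-prime ζ roots (not-all-one ζ 1≤k k<p Σ≡0)
  open Classification p-prime (proj₁ root) (proj₂ root) ζ roots
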